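{- Let $G$ be a finite simple cubic (3-regular) planar graph, and let $C$ be a cycle in $G$ of length $3$, $4$, or $5$. Fix a planar embedding of $G$; by the Jordan curve theorem, $C$ separates the plane into an interior and an exterior region. Let $H_0$ be the subgraph of $G$ induced by the vertices of $C$ together with the vertices lying in the interior of $C$, and let $H_1$ be the subgraph of $G$ induced by the vertices of $C$ together with the vertices lying in the exterior of $C$. If each of $H_0$ and $H_1$ admits a distance-2 coloring using $m$ colors, then $G$ admits a distance-2 coloring using $m$ colors.
   Context: All graphs are finite, undirected and simple. A distance-2 coloring of a graph $H$ is an assignment of colors to the vertices of $H$ such that any two distinct vertices joined by a path of length one or two in $H$ receive different colors. A graph is cubic if every vertex has degree exactly $3$. -}

module Defs where

open import Data.Nat using (ℕ; zero; suc)
open import Data.Bool using (Bool; true; false)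
open import Data.Fin using (Fin; toℕ)
open import Data.List using (length; filterᵇ; allFin)
open import Data.Product using (Σ; ∃; _×_; _,_)
open import Data.Sum using (_⊎_)
open import Relation.Nullary using (¬_)
open import Relation.Binary.PropositionalEquality using (_≡_; _≢_)
open import Function.Definitions using (Injective)

record Graph (n : ℕ) : Set where
  field
    adj   : Fin n → Fin n → Bool
    sym   : ∀ u v → adj u v ≡ adj v u
    irrefl : ∀ v → adj v v ≡ false

open Graph public

Adj : ∀ {n} → Graph n → Fin n → Fin n → Set
Adj G u v = adj G u v ≡ true

degree : ∀ {n} → Graph n → Fin n → ℕ
degree {n} G v = length (filterᵇ (adj G v) (allFin n))

Cubic : ∀ {n} → Graph n → Set
Cubic G = ∀ v → degree G v ≡ 3

CycSucc : ∀ {k} → Fin k → Fin k → Set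
CycSucc {k} i j = (suc (toℕ i) ≡ toℕ j) ⊎ ((suc (toℕ i) ≡ k) × (toℕ j ≡ 0))

-- A cycle of length k in G (k ≥ 3 is imposed where it is used):
-- k distinct vertices, cyclically consecutive ones adjacent.
record Cycle {n} (G : Graph n) (k : ℕ) : Set where
  field
    vtx  : Fin k → Fin n
    inj  : Injective _≡_ _≡_ vtx
    edge : ∀ i j → CycSucc i j → Adj G (vtx i) (vtx j)

open Cycle public

OnCycle : ∀ {n} {G : Graph n} {k} → Cycle G k → Fin n → Set
OnCycle {k = k} C v = Σ (Fin k) λ i → vtx C i ≡ v

data Region : Set where
  onC interior exterior : Region

-- The (combinatorial content of the) Jordan-curve separation of G by C:
-- each vertex lies on C, in the interior or in the exterior; the
-- vertices on C are exactly those labelled onC, and no edge joins an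
-- interior vertex to an exterior vertex.
record Separation {n} {G : Graph n} {k} (C : Cycle G k) : Set where
  field
    region   : Fin n → Region
    onC→     : ∀ v → region v ≡ onC → OnCycle C v
    →onC     : ∀ v → OnCycle C v → region v ≡ onC
    no-cross : ∀ u v → Adj G u v → region u ≡ interior → region v ≢ exterior

open Separation public

-- Colours of vertices outside S
-- are irrelevant.
D2ColoringOn : ∀ {n} → Graph n → (Fin n → Set) → (m : ℕ) → (Fin n → Fin m) → Set
D2ColoringOn G S m c =
  ∀ u v → S u → S v → u ≢ v →
    (Adj G u v ⊎ (∃ λ w → S w × Adj G u w × Adj G w v)) →
    c u ≢ c v

D2Coloring : ∀ {n} → Graph n → (m : ℕ) → (Fin n → Fin m) → Set
D2Coloring G m c =
  ∀ u v → u ≢ v → (Adj G u v ⊎ (∃ λ w → Adj G u w × Adj G w v)) → c u ≢ c v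

InH₀ : ∀ {n} {G : Graph n} {k} {C : Cycle G k} → Separation C → Fin n → Set
InH₀ σ v = region σ v ≢ exterior

InH₁ : ∀ {n} {G : Graph n} {k} {C : Cycle G k} → Separation C → Fin n → Set
InH₁ σ v = region σ v ≢ interior

{-# OPTIONS --safe #-}
-- Since the cycle has at most five vertices, any two of them are joined by a path of
-- length at most two along the cycle; hence both colourings are injective on C, and after
-- permuting the colours of the H₁-colouring they agree on C and can be glued.  A short
-- path between two vertices of the same side either stays on that side or has both ends
-- on C, where the cycle provides a replacement inside that side.  A short path from the
-- interior to the exterior would need a middle vertex on C with two neighbours off C
-- besides its two cycle-neighbours, i.e. of degree at least four.
module Submission where

open import Defs hiding (sym)
open import Data.Nat as ℕ using (ℕ; zero; suc; _≤_)
open import Data.Nat.Properties using (<-irrefl)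
open import Data.Fin using (Fin; zero; suc; toℕ; _≟_)
open import Data.Fin.Properties using (all?; any?; injective⇒≤; suc-injective; 0≢1+n)
open import Data.Fin.Permutation using (Permutation′; _⟨$⟩ʳ_; _∘ₚ_; transpose; id)
open import Data.Product using (Σ; ∃; ∃₂; _×_; _,_; proj₁; proj₂)
open import Data.Sum using (_⊎_; inj₁; inj₂)
open import Data.Empty using (⊥-elim)
open import Data.Bool using (T)
open import Data.List as List using (List; filterᵇ; allFin)
open import Data.List.Membership.Propositional using (_∈_)
open import Data.List.Membership.Propositional.Properties using (∈-filter⁺; ∈-allFin)
open import Data.List.Relation.Unary.Any using (index)
open import Data.List.Relation.Unary.Any.Properties using (lookup-index)
open import Data.Vec using (Vec; []; _∷_; lookup)
open import Data.Vec.Relation.Unary.All using (All; []; _∷_)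
open import Data.Vec.Relation.Unary.All.Properties using (lookup⁺)
open import Data.Vec.Relation.Unary.Unique.Propositional using (Unique; []; _∷_)
open import Data.Vec.Relation.Unary.Unique.Propositional.Properties using (lookup-injective)
open import Function using (_∘_; case_of_)
open import Function.Bundles using (Injection)
open import Function.Properties.Inverse using (↔⇒↣)
open import Function.Definitions using (Injective)
open import Relation.Nullary using (¬_; Dec; yes; no; ¬?)
open import Relation.Nullary.Decidable using (T?; from-yes; decidable-stable; _×-dec_; _⊎-dec_; _→-dec_)
open import Relation.Binary.PropositionalEquality

ShortLength : ℕ → Set
ShortLength k = k ≡ 3 ⊎ k ≡ 4 ⊎ k ≡ 5

module _ {k : ℕ} where

  CycAdj : Fin k → Fin k → Set
  CycAdj i j = CycSucc i j ⊎ CycSucc j i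

  WithinTwo : Fin k → Fin k → Set
  WithinTwo i j = CycAdj i j ⊎ ∃ λ l → CycAdj i l × CycAdj l j

  cycSucc? : (i j : Fin k) → Dec (CycSucc i j)
  cycSucc? i j = (suc (toℕ i) ℕ.≟ toℕ j) ⊎-dec ((suc (toℕ i) ℕ.≟ k) ×-dec (toℕ j ℕ.≟ 0))

  cycAdj? : (i j : Fin k) → Dec (CycAdj i j)
  cycAdj? i j = cycSucc? i j ⊎-dec cycSucc? j i

  withinTwo? : (i j : Fin k) → Dec (WithinTwo i j)
  withinTwo? i j = cycAdj? i j ⊎-dec any? λ l → cycAdj? i l ×-dec cycAdj? l j

  allWithinTwo? : Dec (∀ (i j : Fin k) → i ≢ j → WithinTwo i j)
  allWithinTwo? = all? λ i → all? λ j → ¬? (i ≟ j) →-dec withinTwo? i j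

  twoNeighbours? : Dec (∀ (i : Fin k) → ∃₂ λ j l → j ≢ l × CycAdj i j × CycAdj i l)
  twoNeighbours? = all? λ i → any? λ j → any? λ l → ¬? (j ≟ l) ×-dec cycAdj? i j ×-dec cycAdj? i l

short-cycle-withinTwo : ∀ {k} → ShortLength k → (i j : Fin k) → i ≢ j → WithinTwo i j
short-cycle-withinTwo (inj₁ refl)        = from-yes (allWithinTwo? {3})
short-cycle-withinTwo (inj₂ (inj₁ refl)) = from-yes (allWithinTwo? {4})
short-cycle-withinTwo (inj₂ (inj₂ refl)) = from-yes (allWithinTwo? {5})

short-cycle-twoNeighbours : ∀ {k} → ShortLength k →
  (i : Fin k) → ∃₂ λ j l → j ≢ l × CycAdj i j × CycAdj i l
short-cycle-twoNeighbours (inj₁ refl)        = from-yes (twoNeighbours? {3})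
short-cycle-twoNeighbours (inj₂ (inj₁ refl)) = from-yes (twoNeighbours? {4})
short-cycle-twoNeighbours (inj₂ (inj₂ refl)) = from-yes (twoNeighbours? {5})

transpose-sends : ∀ {m} (i j : Fin m) → transpose i j ⟨$⟩ʳ i ≡ j
transpose-sends i j with i ≟ i
... | yes _  = refl
... | no i≢i = ⊥-elim (i≢i refl)

transpose-fixes : ∀ {m} (i j x : Fin m) → x ≢ i → x ≢ j → transpose i j ⟨$⟩ʳ x ≡ x
transpose-fixes i j x x≢i x≢j with x ≟ i
... | yes x≡i = ⊥-elim (x≢i x≡i)
... | no _ with x ≟ j
...   | yes x≡j = ⊥-elim (x≢j x≡j)
...   | no _    = refl

permutation-injective : ∀ {m} (π : Permutation′ m) → Injective _≡_ _≡_ (π ⟨$⟩ʳ_)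
permutation-injective π = Injection.injective (↔⇒↣ π)

-- Match the images of 1, …, k by induction, then move the image of 0 into place by a
-- transposition; it fixes the other images since both maps are injective.
injections-differ-by-permutation : ∀ {k m} (a b : Fin k → Fin m) →
  Injective _≡_ _≡_ a → Injective _≡_ _≡_ b →
  Σ (Permutation′ m) λ π → ∀ i → π ⟨$⟩ʳ a i ≡ b i
injections-differ-by-permutation {zero} a b _ _ = id , λ ()
injections-differ-by-permutation {suc k} {m} a b a-inj b-inj = π ∘ₚ τ , matches
  where
  IH : Σ (Permutation′ m) λ π → ∀ i → π ⟨$⟩ʳ a (suc i) ≡ b (suc i)
  IH = injections-differ-by-permutation (a ∘ suc) (b ∘ suc)
    (suc-injective ∘ a-inj) (suc-injective ∘ b-inj)
  π : Permutation′ m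
  π = proj₁ IH
  τ : Permutation′ m
  τ = transpose (π ⟨$⟩ʳ a zero) (b zero)
  matches : ∀ i → τ ⟨$⟩ʳ (π ⟨$⟩ʳ a i) ≡ b i
  matches zero    = transpose-sends (π ⟨$⟩ʳ a zero) (b zero)
  matches (suc i) = trans (cong (τ ⟨$⟩ʳ_) (proj₂ IH i))
    (transpose-fixes _ _ (b (suc i))
      (λ e → 0≢1+n (sym (a-inj (permutation-injective π (trans (proj₂ IH i) e)))))
      (λ e → 0≢1+n (sym (b-inj e))))

module _ {n} (G : Graph n) where

  ShortPath : Fin n → Fin n → Set
  ShortPath u v = Adj G u v ⊎ ∃ λ w → Adj G u w × Adj G w v

  ShortPathWithin : (Fin n → Set) → Fin n → Fin n → Set
  ShortPathWithin S u v = Adj G u v ⊎ ∃ λ w → S w × Adj G u w × Adj G w v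

  Adj-sym : ∀ {u v} → Adj G u v → Adj G v u
  Adj-sym {u} {v} a = trans (Graph.sym G v u) a

  ShortPath-sym : ∀ {u v} → ShortPath u v → ShortPath v u
  ShortPath-sym (inj₁ a)             = inj₁ (Adj-sym a)
  ShortPath-sym (inj₂ (w , uw , wv)) = inj₂ (w , Adj-sym wv , Adj-sym uw)

  D2ColoringOn-∘ : ∀ {S m m′} {c : Fin n → Fin m} {f : Fin m → Fin m′} →
    Injective _≡_ _≡_ f → D2ColoringOn G S m c → D2ColoringOn G S m′ (f ∘ c)
  D2ColoringOn-∘ f-inj c-ok u v su sv u≢v p = c-ok u v su sv u≢v p ∘ f-inj

  distinct-neighbours≤degree : ∀ {d} w (xs : Vec (Fin n) d) →
    Unique xs → All (Adj G w) xs → d ≤ degree G w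
  distinct-neighbours≤degree {d} w xs xs-unique xs-adj = injective⇒≤ {f = position} position-injective
    where
    neighbours : List (Fin n)
    neighbours = filterᵇ (adj G w) (allFin n)
    member : ∀ i → lookup xs i ∈ neighbours
    member i = ∈-filter⁺ (λ x → T? (adj G w x)) (∈-allFin _) (subst T (sym (lookup⁺ xs-adj i)) _)
    position : Fin d → Fin (List.length neighbours)
    position i = index (member i)
    position-injective : Injective _≡_ _≡_ position
    position-injective {i} {j} e = lookup-injective xs-unique i j (begin
      lookup xs i                          ≡⟨ lookup-index (member i) ⟩
      List.lookup neighbours (position i)  ≡⟨ cong (List.lookup neighbours) e ⟩
      List.lookup neighbours (position j)  ≡⟨ lookup-index (member j) ⟨
      lookup xs j                          ∎)
      where open ≡-Reasoning

module _ {n} {G : Graph n} {k} (C : Cycle G k) where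

  CycAdj-edge : ∀ {i j} → CycAdj i j → Adj G (vtx C i) (vtx C j)
  CycAdj-edge {i} {j} (inj₁ i→j) = edge C i j i→j
  CycAdj-edge {i} {j} (inj₂ j→i) = Adj-sym G (edge C j i j→i)

  ContainsCycle : (Fin n → Set) → Set
  ContainsCycle S = ∀ i → S (vtx C i)

  LeavesOnlyVia : (Fin n → Set) → Set
  LeavesOnlyVia S = ∀ {u w} → S u → Adj G u w → S w ⊎ OnCycle C u

  cycle-shortPathWithin : ∀ {S u v} → ShortLength k → ContainsCycle S →
    OnCycle C u → OnCycle C v → u ≢ v → ShortPathWithin G S u v
  cycle-shortPathWithin short C⊆S (i , refl) (j , refl) u≢v
    with short-cycle-withinTwo short i j (u≢v ∘ cong (vtx C))
  ... | inj₁ i~j             = inj₁ (CycAdj-edge i~j)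
  ... | inj₂ (l , i~l , l~j) = inj₂ (vtx C l , C⊆S l , CycAdj-edge i~l , CycAdj-edge l~j)

  cycle-colours-injective : ∀ {S m} {c : Fin n → Fin m} → ShortLength k → ContainsCycle S →
    D2ColoringOn G S m c → Injective _≡_ _≡_ (c ∘ vtx C)
  cycle-colours-injective short C⊆S c-ok {i} {j} e = decidable-stable (i ≟ j) λ i≢j →
    let u≢v = i≢j ∘ inj C in
    c-ok (vtx C i) (vtx C j) (C⊆S i) (C⊆S j) u≢v
      (cycle-shortPathWithin short C⊆S (i , refl) (j , refl) u≢v) e

  shortPathWithin : ∀ {S u v} → ShortLength k → ContainsCycle S → LeavesOnlyVia S →
    S u → S v → u ≢ v → ShortPath G u v → ShortPathWithin G S u v
  shortPathWithin short C⊆S leaves su sv u≢v (inj₁ uv) = inj₁ uv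
  shortPathWithin short C⊆S leaves su sv u≢v (inj₂ (w , uw , wv))
    with leaves su uw | leaves sv (Adj-sym G wv)
  ... | inj₁ sw  | _        = inj₂ (w , sw , uw , wv)
  ... | inj₂ _   | inj₁ sw  = inj₂ (w , sw , uw , wv)
  ... | inj₂ u∈C | inj₂ v∈C = cycle-shortPathWithin short C⊆S u∈C v∈C u≢v

  D2ColoringOn-shortPath : ∀ {S m} {c : Fin n → Fin m} → ShortLength k →
    ContainsCycle S → LeavesOnlyVia S → D2ColoringOn G S m c →
    ∀ {u v} → S u → S v → u ≢ v → ShortPath G u v → c u ≢ c v
  D2ColoringOn-shortPath short C⊆S leaves c-ok su sv u≢v p =
    c-ok _ _ su sv u≢v (shortPathWithin short C⊆S leaves su sv u≢v p)

  cubic-unique-neighbour-off-cycle : Cubic G → ShortLength k → ∀ i {u v} →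
    ¬ OnCycle C u → ¬ OnCycle C v → Adj G (vtx C i) u → Adj G (vtx C i) v → u ≡ v
  cubic-unique-neighbour-off-cycle cubic short i {u} {v} u∉C v∉C iu iv
    with short-cycle-twoNeighbours short i
  ... | j , l , j≢l , i~j , i~l = decidable-stable (u ≟ v) λ u≢v →
    <-irrefl refl (subst (4 ≤_) (cubic (vtx C i))
      (distinct-neighbours≤degree G (vtx C i) _ (distinct u≢v) adjacent))
    where
    cycle-vertex-≢ : ∀ {x} → ¬ OnCycle C x → ∀ t → vtx C t ≢ x
    cycle-vertex-≢ x∉C t e = x∉C (t , e)

    distinct : u ≢ v → Unique (vtx C j ∷ vtx C l ∷ u ∷ v ∷ [])
    distinct u≢v = (j≢l ∘ inj C ∷ cycle-vertex-≢ u∉C j ∷ cycle-vertex-≢ v∉C j ∷ [])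
                 ∷ (cycle-vertex-≢ u∉C l ∷ cycle-vertex-≢ v∉C l ∷ [])
                 ∷ (u≢v ∷ [])
                 ∷ [] ∷ []

    adjacent : All (Adj G (vtx C i)) (vtx C j ∷ vtx C l ∷ u ∷ v ∷ [])
    adjacent = CycAdj-edge i~j ∷ CycAdj-edge i~l ∷ iu ∷ iv ∷ []

pickSide : {A : Set} → Region → A → A → A
pickSide onC      x y = x
pickSide interior x y = x
pickSide exterior x y = y

module _ {n} {G : Graph n} {k} {C : Cycle G k} (σ : Separation C) where

  onC-region : ∀ i → region σ (vtx C i) ≡ onC
  onC-region i = →onC σ (vtx C i) (i , refl)

  off-cycle : ∀ {v r} → region σ v ≡ r → r ≢ onC → ¬ OnCycle C v
  off-cycle {v} refl r≢onC v∈C = r≢onC (→onC σ v v∈C)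

  H₀-contains-cycle : ContainsCycle C (InH₀ σ)
  H₀-contains-cycle i = subst (_≢ exterior) (sym (onC-region i)) λ ()

  H₁-contains-cycle : ContainsCycle C (InH₁ σ)
  H₁-contains-cycle i = subst (_≢ interior) (sym (onC-region i)) λ ()

  H₀-leavesOnlyVia : LeavesOnlyVia C (InH₀ σ)
  H₀-leavesOnlyVia {u} {w} u∈H₀ uw with region σ w in rw | region σ u in ru
  ... | onC      | _        = inj₁ λ ()
  ... | interior | _        = inj₁ λ ()
  ... | exterior | onC      = inj₂ (onC→ σ u ru)
  ... | exterior | interior = ⊥-elim (no-cross σ u w uw ru rw)
  ... | exterior | exterior = ⊥-elim (u∈H₀ refl)

  H₁-leavesOnlyVia : LeavesOnlyVia C (InH₁ σ)
  H₁-leavesOnlyVia {u} {w} u∈H₁ uw with region σ w in rw | region σ u in ru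
  ... | onC      | _        = inj₁ λ ()
  ... | exterior | _        = inj₁ λ ()
  ... | interior | onC      = inj₂ (onC→ σ u ru)
  ... | interior | exterior = ⊥-elim (no-cross σ w u (Adj-sym G uw) rw ru)
  ... | interior | interior = ⊥-elim (u∈H₁ refl)

  no-shortPath-across : Cubic G → ShortLength k → ∀ {u v} →
    region σ u ≡ interior → region σ v ≡ exterior → ¬ ShortPath G u v
  no-shortPath-across cubic short ru rv (inj₁ uv) = no-cross σ _ _ uv ru rv
  no-shortPath-across cubic short {u} {v} ru rv (inj₂ (w , uw , wv)) with region σ w in rw
  ... | interior = no-cross σ w v wv rw rv
  ... | exterior = no-cross σ u w uw ru rw
  ... | onC with onC→ σ w rw
  ...   | i , refl with cubic-unique-neighbour-off-cycle C cubic short i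
                          (off-cycle ru λ ()) (off-cycle rv λ ()) (Adj-sym G uw) wv
  ...     | refl = case trans (sym ru) rv of λ ()

  glue : ∀ {m} → (Fin n → Fin m) → (Fin n → Fin m) → Fin n → Fin m
  glue c₀ c₁ v = pickSide (region σ v) (c₀ v) (c₁ v)

  glue-H₀ : ∀ {m} (c₀ c₁ : Fin n → Fin m) {v} → InH₀ σ v → glue c₀ c₁ v ≡ c₀ v
  glue-H₀ c₀ c₁ {v} v∈H₀ with region σ v
  ... | onC      = refl
  ... | interior = refl
  ... | exterior = ⊥-elim (v∈H₀ refl)

  glue-H₁ : ∀ {m} (c₀ c₁ : Fin n → Fin m) → (∀ i → c₀ (vtx C i) ≡ c₁ (vtx C i)) →
    ∀ {v} → InH₁ σ v → glue c₀ c₁ v ≡ c₁ v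
  glue-H₁ c₀ c₁ agree {v} v∈H₁ with region σ v in rv
  ... | exterior = refl
  ... | interior = ⊥-elim (v∈H₁ refl)
  ... | onC with onC→ σ v rv
  ...   | i , refl = agree i

  same-side-or-across : ∀ u v → (InH₀ σ u × InH₀ σ v) ⊎ (InH₁ σ u × InH₁ σ v)
    ⊎ (region σ u ≡ interior × region σ v ≡ exterior)
    ⊎ (region σ v ≡ interior × region σ u ≡ exterior)
  same-side-or-across u v with region σ u | region σ v
  ... | onC      | onC      = inj₁ ((λ ()) , (λ ()))
  ... | onC      | interior = inj₁ ((λ ()) , (λ ()))
  ... | onC      | exterior = inj₂ (inj₁ ((λ ()) , (λ ())))
  ... | interior | onC      = inj₁ ((λ ()) , (λ ()))
  ... | interior | interior = inj₁ ((λ ()) , (λ ()))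
  ... | interior | exterior = inj₂ (inj₂ (inj₁ (refl , refl)))
  ... | exterior | onC      = inj₂ (inj₁ ((λ ()) , (λ ())))
  ... | exterior | interior = inj₂ (inj₂ (inj₂ (refl , refl)))
  ... | exterior | exterior = inj₂ (inj₁ ((λ ()) , (λ ())))

  glue-D2Coloring : ∀ {m} {c₀ c₁ : Fin n → Fin m} → Cubic G → ShortLength k →
    D2ColoringOn G (InH₀ σ) m c₀ → D2ColoringOn G (InH₁ σ) m c₁ →
    (∀ i → c₀ (vtx C i) ≡ c₁ (vtx C i)) → D2Coloring G m (glue c₀ c₁)
  glue-D2Coloring {c₀ = c₀} {c₁} cubic short c₀-ok c₁-ok agree u v u≢v p
    with same-side-or-across u v
  ... | inj₁ (u∈H₀ , v∈H₀) =
    D2ColoringOn-shortPath C short H₀-contains-cycle H₀-leavesOnlyVia c₀-ok u∈H₀ v∈H₀ u≢v p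
      ∘ subst₂ _≡_ (glue-H₀ c₀ c₁ u∈H₀) (glue-H₀ c₀ c₁ v∈H₀)
  ... | inj₂ (inj₁ (u∈H₁ , v∈H₁)) =
    D2ColoringOn-shortPath C short H₁-contains-cycle H₁-leavesOnlyVia c₁-ok u∈H₁ v∈H₁ u≢v p
      ∘ subst₂ _≡_ (glue-H₁ c₀ c₁ agree u∈H₁) (glue-H₁ c₀ c₁ agree v∈H₁)
  ... | inj₂ (inj₂ (inj₁ (ru , rv))) = λ _ → no-shortPath-across cubic short ru rv p
  ... | inj₂ (inj₂ (inj₂ (rv , ru))) = λ _ → no-shortPath-across cubic short rv ru (ShortPath-sym G p)

lemma1 : (n : ℕ) (G : Graph n) → Cubic G →
         (k : ℕ) → (k ≡ 3 ⊎ k ≡ 4 ⊎ k ≡ 5) →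
         (C : Cycle G k) (σ : Separation C) (m : ℕ) →
         Σ (Fin n → Fin m) (D2ColoringOn G (InH₀ σ) m) →
         Σ (Fin n → Fin m) (D2ColoringOn G (InH₁ σ) m) →
         Σ (Fin n → Fin m) (D2Coloring G m)
lemma1 n G cubic k short C σ m (c₀ , c₀-ok) (c₁ , c₁-ok) =
  glue σ c₀ ((π ⟨$⟩ʳ_) ∘ c₁) ,
  glue-D2Coloring σ cubic short c₀-ok
    (D2ColoringOn-∘ G (permutation-injective π) c₁-ok) (sym ∘ π-matches)
  where
  boundary-match : Σ (Permutation′ m) λ π → ∀ i → π ⟨$⟩ʳ c₁ (vtx C i) ≡ c₀ (vtx C i)
  boundary-match = injections-differ-by-permutation (c₁ ∘ vtx C) (c₀ ∘ vtx C)
    (cycle-colours-injective C short (H₁-contains-cycle σ) c₁-ok)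
    (cycle-colours-injective C short (H₀-contains-cycle σ) c₀-ok)
  π : Permutation′ m
  π = proj₁ boundary-match
  π-matches : ∀ i → π ⟨$⟩ʳ c₁ (vtx C i) ≡ c₀ (vtx C i)
  π-matches = proj₂ boundary-match
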